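{- Let $s,k,t \in \mathbb{N}$ with $k \geq t \geq 2$ and let $r = s(k-t+1)+1$. There is an edge-colouring of the complete $k$-uniform hypergraph $\mathcal{K}_{\mathbb{N}}^{(k)}$ (vertex set $\mathbb{N}$, edge set $\binom{\mathbb{N}}{k}$) with $r$ colours such that there do not exist $s$ monochromatic $t$-tight Berge-paths (finite or infinite) whose cores together cover $\mathbb{N}$.
   Context: A $k$-graph is a pair $(V,\mathcal{E})$ with $\mathcal{E} \subseteq \binom{V}{k}$. For integers $2 \le t \le k$ and $\ell \ge 1$, a finite $t$-tight Berge-path of length $\ell$ in a $k$-graph is a pair $(X,F)$ where $X=\{v_1,\dots,v_{\ell+t-1}\}$ is a set of $\ell+t-1$ distinct vertices, $F=\{e_1,\dots,e_\ell\}$ is a set of $\ell$ distinct edges, and $v_i,v_{i+1},\dots,v_{i+t-1} \in e_i$ for all $i\in[\ell]$. A $t$-tight Berge-path of length $0$ is a pair $(\{v\},\emptyset)$. An infinite $t$-tight Berge-path is a pair $(X,F)$ with $X=\{v_i : i\in\mathbb{N}\}$ (distinct vertices), $F=\{e_i: i\in\mathbb{N}\}$ (distinct edges) and $v_i,\dots,v_{i+t-1}\in e_i$ for all $i$. $X$ is called the core of the path. Given an edge-colouring $\varphi$, a path $(X,F)$ is monochromatic (in colour $c$) if $\varphi(f)=c$ for all $f\in F$. -}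

module Defs where

open import Data.Nat using (ℕ; _+_; _∸_; _<_; _≤_)
open import Data.Fin using (Fin)
open import Data.List using (List; length)
open import Data.List.Membership.Propositional using (_∈_)
open import Data.List.Relation.Unary.Linked using (Linked)
open import Data.Product using (Σ; ∃; _×_; proj₁)
open import Data.Unit using (⊤)
open import Relation.Binary.PropositionalEquality using (_≡_)

-- A k-edge of the complete k-graph on ℕ: a k-element subset of ℕ,
-- represented canonically as a strictly increasing list of length k.
Edge : ℕ → Set
Edge k = Σ (List ℕ) λ xs → (length xs ≡ k) × Linked _<_ xs

_∈ₑ_ : {k : ℕ} → ℕ → Edge k → Set
v ∈ₑ e = v ∈ proj₁ e

-- Raw data of a t-tight Berge-path: length 0 ({v},∅), finite of length ℓ
-- (vertices v 0 .. v (ℓ+t-2), edges e 0 .. e (ℓ-1)), or infinite.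
-- (Indices are 0-based.)
data Path (k : ℕ) : Set where
  trivial  : ℕ → Path k
  finite   : (ℓ : ℕ) → (ℕ → ℕ) → (ℕ → Edge k) → Path k
  infinite : (ℕ → ℕ) → (ℕ → Edge k) → Path k

IsMonoBergePath : {k r : ℕ} → (t : ℕ) → (Edge k → Fin r) → Path k → Set
IsMonoBergePath t φ (trivial v) = ⊤
IsMonoBergePath t φ (finite ℓ v e) =
  (1 ≤ ℓ)
  × (∀ i j → i < ℓ + t ∸ 1 → j < ℓ + t ∸ 1 → v i ≡ v j → i ≡ j)
  × (∀ i j → i < ℓ → j < ℓ → proj₁ (e i) ≡ proj₁ (e j) → i ≡ j)
  × (∀ i j → i < ℓ → j < t → v (i + j) ∈ₑ e i)
  × ∃ λ c → ∀ i → i < ℓ → φ (e i) ≡ c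
IsMonoBergePath t φ (infinite v e) =
  (∀ i j → v i ≡ v j → i ≡ j)
  × (∀ i j → proj₁ (e i) ≡ proj₁ (e j) → i ≡ j)
  × (∀ i j → j < t → v (i + j) ∈ₑ e i)
  × ∃ λ c → ∀ i → φ (e i) ≡ c

InCore : {k : ℕ} → (t : ℕ) → Path k → ℕ → Set
InCore t (trivial v) x = v ≡ x
InCore t (finite ℓ v e) x = ∃ λ i → (i < ℓ + t ∸ 1) × (v i ≡ x)
InCore t (infinite v e) x = ∃ λ i → v i ≡ x

module Submission where

-- Give every vertex a palette of s colours, constant on the blocks [2^(nL), 2^(nL+N)) with
-- L = N + 1 and N = s t^2, and running through all s-tuples of colours; colour an edge by one
-- of the r > s(k-t+1) colours missing from the palettes of its k-t+1 smallest vertices.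
-- Any t distinct vertices of an edge include one of its k-t+1 smallest, so a window of t
-- consecutive path vertices in an edge of colour c cannot meet a block whose palettes contain c
-- while staying above the block's start a. Taking the block [a, b) whose palette lists the
-- colours of the s paths, every x < b is then determined by a path, a window vertex u < a and
-- the offsets of u and x in the window: at most a s t^2 < b possibilities.

open import Defs
open import Data.Nat
  using (ℕ; zero; suc; _+_; _*_; _∸_; _^_; _≤_; _<_; z≤n; s≤s; s≤s⁻¹; z<s; NonZero; >-nonZero; _/_)
open import Data.Nat.Properties
open import Data.Nat.DivMod using (_mod_; _%_; m<n⇒m/n≡0; m*n/n≡m; /-monoˡ-≤; m<n*o⇒m/o<n; +-distrib-/-∣ʳ; [m+kn]%n≡m%n; m<n⇒m%n≡m)
open import Data.Nat.Divisibility using (divides-refl)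
open import Data.Nat.Logarithm using (⌊log₂_⌋; ⌊log₂⌋-mono-≤; ⌊log₂[2^n]⌋≡n)
open import Data.Fin using (Fin; toℕ; fromℕ<; combine) renaming (zero to 0F; suc to 1+)
open import Data.Fin.Properties
  using (injective⇒≤; any?; ¬∀⟶∃¬; toℕ-injective; toℕ-fromℕ<; toℕ<n; combine-injective)
  renaming (_≟_ to _≟ᶠ_)
open import Data.List using (List; []; _∷_; length; take; drop; lookup; concatMap)
open import Data.List.Properties using (length-++; length-take; length-drop; take++drop≡id)
open import Data.List.Membership.Propositional using (_∈_; _∉_)
open import Data.List.Membership.Propositional.Properties using (∈-++⁻; ∈-concatMap⁺)
import Data.List.Membership.DecPropositional as DecMembership
open import Data.List.Relation.Unary.Any as Any using (here; there; index)
open import Data.List.Relation.Unary.Any.Properties using (lookup-index)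
import Data.List.Relation.Unary.All as All
open import Data.List.Relation.Unary.Linked as Linked using (Linked)
open import Data.List.Relation.Unary.Linked.Properties using (Linked⇒All)
open import Data.Product using (Σ; ∃; _×_; _,_; proj₁; proj₂)
open import Data.Sum using (_⊎_; [_,_])
open import Data.Unit using (⊤; tt)
open import Data.Empty using (⊥-elim)
open import Function using (id; _∘_)
open import Function.Definitions using (Injective)
open import Relation.Nullary using (¬_; yes; no)
open import Relation.Binary.PropositionalEquality using (_≡_; refl; sym; trans; cong; cong₂; subst; module ≡-Reasoning)

open DecMembership _≟_ using () renaming (_∈?_ to _∈ℕ?_)

injective⇒≤length : ∀ {A : Set} {n} {ys : List A} (g : Fin n → A) →
  Injective _≡_ _≡_ g → (∀ i → g i ∈ ys) → n ≤ length ys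
injective⇒≤length {ys = ys} g g-inj g∈ys = injective⇒≤ {f = index ∘ g∈ys} λ {i} {j} eq →
  g-inj (begin
    g i                         ≡⟨ lookup-index (g∈ys i) ⟩
    lookup ys (index (g∈ys i))  ≡⟨ cong (lookup ys) eq ⟩
    lookup ys (index (g∈ys j))  ≡⟨ lookup-index (g∈ys j) ⟨
    g j                         ∎)
  where open ≡-Reasoning

∈-take⊎∈-drop : ∀ {A : Set} {x : A} n xs → x ∈ xs → x ∈ take n xs ⊎ x ∈ drop n xs
∈-take⊎∈-drop {x = x} n xs x∈xs = ∈-++⁻ (take n xs) (subst (x ∈_) (sym (take++drop≡id n xs)) x∈xs)

head<tail : ∀ {h y} {xs : List ℕ} → Linked _<_ (h ∷ xs) → y ∈ xs → h < y
head<tail {xs = _ ∷ _} sorted = All.lookup (Linked⇒All <-trans (Linked.head sorted) (Linked.tail sorted))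

take-downwardClosed : ∀ n {xs : List ℕ} {y z} → Linked _<_ xs →
  y ∈ xs → z ∈ take n xs → y ≤ z → y ∈ take n xs
take-downwardClosed (suc n) sorted (here refl) _ _ = here refl
take-downwardClosed (suc n) sorted (there y∈xs) (here refl) y≤z =
  ⊥-elim (<⇒≱ (head<tail sorted y∈xs) y≤z)
take-downwardClosed (suc n) sorted (there y∈xs) (there z∈xs) y≤z =
  there (take-downwardClosed n (Linked.tail sorted) y∈xs z∈xs y≤z)

length-concatMap : ∀ {A B : Set} {s} (f : A → List B) → (∀ x → length (f x) ≡ s) →
  ∀ xs → length (concatMap f xs) ≡ length xs * s
length-concatMap f f-length [] = refl
length-concatMap f f-length (x ∷ xs) =
  trans (length-++ (f x)) (cong₂ _+_ (f-length x) (length-concatMap f f-length xs))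

fresh : ∀ {r} (cs : List (Fin r)) → length cs < r → ∃ λ c → c ∉ cs
fresh {r} cs |cs|<r = ¬∀⟶∃¬ r (_∈ cs) (_∈? cs) λ all∈ → <⇒≱ |cs|<r (injective⇒≤length id id all∈)
  where open DecMembership (_≟ᶠ_ {r}) using (_∈?_)

n<2^n : ∀ n → n < 2 ^ n
n<2^n zero = z<s
n<2^n (suc n) = subst (_≤ 2 ^ suc n) (+-comm (suc n) 1)
  (+-mono-≤ (n<2^n n) (subst (0 <_) (sym (+-identityʳ (2 ^ n))) (m^n>0 2 n)))

Throughout : (ℕ → Set) → ℕ → ℕ → Set
Throughout P a b = ∀ y → a ≤ y → y < b → P y

InjectiveOn : (ℕ → Set) → (ℕ → ℕ) → Set
InjectiveOn Pos v = ∀ {i j} → Pos i → Pos j → v i ≡ v j → i ≡ j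

Locates : ∀ {a t} → (ℕ → Set) → (ℕ → ℕ) → Fin a × Fin t × Fin t → ℕ → Set
Locates Pos v (u , q , d) x =
  ∃ λ i → Pos (i + toℕ q) × v (i + toℕ q) ≡ toℕ u × v (i + toℕ d) ≡ x

locates-unique : ∀ {a t Pos v} {w : Fin a × Fin t × Fin t} {x y} →
  InjectiveOn Pos v → Locates Pos v w x → Locates Pos v w y → x ≡ y
locates-unique {v = v} {w = _ , q , d} v-inj (i , pos , vq≡u , vd≡x) (j , pos′ , vq≡u′ , vd≡y) =
  trans (sym vd≡x) (trans (cong (λ h → v (h + toℕ d)) i≡j) vd≡y)
  where
  i≡j : i ≡ j
  i≡j = +-cancelʳ-≡ (toℕ q) i j (v-inj pos pos′ (trans vq≡u (sym vq≡u′)))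

Located : ∀ {k a} t → Path k → Fin a × Fin t × Fin t → ℕ → Set
Located t (trivial v)    _ x = v ≡ x
Located t (finite ℓ v e)   = Locates (_< ℓ + t ∸ 1) v
Located t (infinite v e)   = Locates (λ _ → ⊤) v

located-unique : ∀ {k r a t} {φ : Edge k → Fin r} {w : Fin a × Fin t × Fin t} {x y} P →
  IsMonoBergePath t φ P → Located t P w x → Located t P w y → x ≡ y
located-unique (trivial v) _ v≡x v≡y = trans (sym v≡x) v≡y
located-unique (finite ℓ v e) (_ , v-inj , _) =
  locates-unique (λ {i} {j} → v-inj i j)
located-unique (infinite v e) (v-inj , _) =
  locates-unique {Pos = λ _ → ⊤} (λ {i} {j} _ _ → v-inj i j)

window-containing : ∀ {ℓ t j} → 0 < t → j < ℓ + t →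
  Σ ℕ λ i → Σ (Fin t) λ d → i ≤ ℓ × i + toℕ d ≡ j
window-containing {ℓ} {t} {j} 0<t j<ℓ+t with j ≤? ℓ
... | yes j≤ℓ = j , fromℕ< 0<t , j≤ℓ , trans (cong (j +_) (toℕ-fromℕ< 0<t)) (+-identityʳ j)
... | no j≰ℓ = ℓ , fromℕ< j∸ℓ<t , ≤-refl , trans (cong (ℓ +_) (toℕ-fromℕ< j∸ℓ<t)) (m+[n∸m]≡n ℓ≤j)
  where
  ℓ≤j : ℓ ≤ j
  ℓ≤j = ≤-trans (n≤1+n ℓ) (≰⇒> j≰ℓ)
  j∸ℓ<t : j ∸ ℓ < t
  j∸ℓ<t = subst (j ∸ ℓ <_) (m+n∸m≡n ℓ t) (∸-monoˡ-< j<ℓ+t ℓ≤j)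

module SmallestVerticesColouring {r : ℕ} (k m s : ℕ) (palette : ℕ → List (Fin r))
  (palette-length : ∀ y → length (palette y) ≡ s) (s*m<r : s * m < r) where

  forbidden : Edge k → List (Fin r)
  forbidden e = concatMap palette (take m (proj₁ e))

  forbidden-length : ∀ e → length (forbidden e) < r
  forbidden-length (xs , _) = begin-strict
    length (concatMap palette (take m xs))  ≡⟨ length-concatMap palette palette-length (take m xs) ⟩
    length (take m xs) * s                  ≤⟨ *-monoˡ-≤ s (subst (_≤ m) (sym (length-take m xs)) (m⊓n≤m m _)) ⟩
    m * s                                   ≡⟨ *-comm m s ⟩
    s * m                                   <⟨ s*m<r ⟩
    r                                       ∎
    where open ≤-Reasoning

  φ : Edge k → Fin r
  φ e = proj₁ (fresh (forbidden e) (forbidden-length e))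

  φ∉palette : ∀ e {y} → y ∈ take m (proj₁ e) → φ e ∉ palette y
  φ∉palette e y∈small φe∈palette =
    proj₂ (fresh (forbidden e) (forbidden-length e))
      (∈-concatMap⁺ palette (Any.map (λ { refl → φe∈palette }) y∈small))

  -- A trivial path has no edges; its colour is arbitrary.
  colourOf : ∀ {t} (P : Path k) → IsMonoBergePath t φ P → Fin r
  colourOf (trivial v)    _ = fromℕ< (≤-trans (s≤s z≤n) s*m<r)
  colourOf (finite ℓ v e) (_ , _ , _ , _ , c , _) = c
  colourOf (infinite v e) (_ , _ , _ , c , _) = c

  module _ {t : ℕ} (k∸m<t : k ∸ m < t) where

    meets-smallest : (e : Edge k) (g : Fin t → ℕ) → Injective _≡_ _≡_ g →
      (∀ q → g q ∈ₑ e) → ∃ λ q → g q ∈ take m (proj₁ e)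
    meets-smallest (xs , |xs|≡k , _) g g-inj g∈e with any? (λ q → g q ∈ℕ? take m xs)
    ... | yes found = found
    ... | no none = ⊥-elim (<⇒≱ k∸m<t (subst (t ≤_) |drop|≡k∸m (injective⇒≤length g g-inj in-drop)))
      where
      |drop|≡k∸m : length (drop m xs) ≡ k ∸ m
      |drop|≡k∸m = trans (length-drop m xs) (cong (_∸ m) |xs|≡k)
      in-drop : ∀ q → g q ∈ drop m xs
      in-drop q = [ (λ small → ⊥-elim (none (q , small))) , id ] (∈-take⊎∈-drop m xs (g∈e q))

    small-vertex-between : ∀ {a b} (e : Edge k) (g : Fin t → ℕ) → Injective _≡_ _≡_ g →
      (∀ q → g q ∈ₑ e) → (∀ q → a ≤ g q) → (d : Fin t) → g d < b →
      ∃ λ y → y ∈ take m (proj₁ e) × a ≤ y × y < b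
    small-vertex-between e g g-inj g∈e a≤g d gd<b with meets-smallest e g g-inj g∈e
    ... | q , gq-small with g q ≤? g d
    ...   | yes gq≤gd = g q , gq-small , a≤g q , ≤-<-trans gq≤gd gd<b
    ...   | no gq≰gd =
      g d , take-downwardClosed m (proj₂ (proj₂ e)) (g∈e d) gq-small (<⇒≤ (≰⇒> gq≰gd)) , a≤g d , gd<b

    escapes-below : ∀ {a b} (e : Edge k) (g : Fin t → ℕ) → Injective _≡_ _≡_ g →
      (∀ q → g q ∈ₑ e) → Throughout (λ y → φ e ∈ palette y) a b →
      (d : Fin t) → g d < b → ∃ λ q → g q < a
    escapes-below {a} e g g-inj g∈e saturated d gd<b with any? (λ q → g q <? a)
    ... | yes below = below
    ... | no none with small-vertex-between e g g-inj g∈e (λ q → ≮⇒≥ (λ gq<a → none (q , gq<a))) d gd<b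
    ...   | y , y-small , a≤y , y<b = ⊥-elim (φ∉palette e y-small (saturated y a≤y y<b))

    locate : ∀ {a b c Pos v x} → InjectiveOn Pos v → (e : Edge k) (i : ℕ) →
      (∀ q → Pos (i + toℕ q)) → (∀ q → v (i + toℕ q) ∈ₑ e) → φ e ≡ c →
      Throughout (λ y → c ∈ palette y) a b → (d : Fin t) → v (i + toℕ d) ≡ x → x < b →
      Σ (Fin a × Fin t × Fin t) λ w → Locates Pos v w x
    locate {v = v} v-inj e i window window∈e refl saturated d refl x<b =
      let q , vq<a = escapes-below e (λ q → v (i + toℕ q)) window-injective window∈e saturated d x<b
      in (fromℕ< vq<a , q , d) , i , window q , sym (toℕ-fromℕ< vq<a) , refl
      where
      window-injective : Injective _≡_ _≡_ (λ q → v (i + toℕ q))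
      window-injective eq = toℕ-injective (+-cancelˡ-≡ i _ _ (v-inj (window _) (window _) eq))

    locate-in-path : ∀ {a b x} → 0 < t → 0 < a → (P : Path k) (M : IsMonoBergePath t φ P) →
      Throughout (λ y → colourOf P M ∈ palette y) a b → x < b → InCore t P x →
      Σ (Fin a × Fin t × Fin t) λ w → Located t P w x
    locate-in-path 0<t 0<a (trivial v) _ _ _ v≡x = (fromℕ< 0<a , fromℕ< 0<t , fromℕ< 0<t) , v≡x
    locate-in-path 0<t 0<a (finite zero v e) (() , _) _ _ _
    locate-in-path 0<t 0<a (finite (suc ℓ) v e) (_ , v-inj , _ , v∈e , _ , coloured) saturated x<b
                   (j , j<ℓ+t , vj≡x) with window-containing {ℓ} 0<t j<ℓ+t
    ... | i , d , i≤ℓ , i+d≡j =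
      locate (λ {i} {j} → v-inj i j) (e i) i (λ q → +-mono-≤-< i≤ℓ (toℕ<n q))
        (λ q → v∈e i (toℕ q) (s≤s i≤ℓ) (toℕ<n q)) (coloured i (s≤s i≤ℓ)) saturated
        d (trans (cong v i+d≡j) vj≡x) x<b
    locate-in-path 0<t 0<a (infinite v e) (v-inj , _ , v∈e , _ , coloured) saturated x<b (j , vj≡x) =
      locate {Pos = λ _ → ⊤} (λ _ _ → v-inj _ _) (e j) j (λ _ → tt) (λ q → v∈e j (toℕ q) (toℕ<n q))
        (coloured j) saturated (fromℕ< 0<t) (trans (cong v j+0≡j) vj≡x) x<b
      where
      j+0≡j : j + toℕ (fromℕ< 0<t) ≡ j
      j+0≡j = trans (cong (j +_) (toℕ-fromℕ< 0<t)) (+-identityʳ j)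

module BaseDigits (r : ℕ) {{_ : NonZero r}} where

  digits : ℕ → ℕ → List (Fin r)
  digits zero    n = []
  digits (suc s) n = n mod r ∷ digits s (n / r)

  length-digits : ∀ s n → length (digits s n) ≡ s
  length-digits zero    n = refl
  length-digits (suc s) n = cong suc (length-digits s (n / r))

  fromDigits : (s : ℕ) → (Fin s → Fin r) → ℕ
  fromDigits zero    C = 0
  fromDigits (suc s) C = toℕ (C 0F) + fromDigits s (C ∘ 1+) * r

  [c+n*r]mod-r≡c : ∀ (c : Fin r) n → (toℕ c + n * r) mod r ≡ c
  [c+n*r]mod-r≡c c n = toℕ-injective (begin
    toℕ ((toℕ c + n * r) mod r)  ≡⟨ toℕ-fromℕ< _ ⟩
    (toℕ c + n * r) % r          ≡⟨ [m+kn]%n≡m%n (toℕ c) n r ⟩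
    toℕ c % r                    ≡⟨ m<n⇒m%n≡m (toℕ<n c) ⟩
    toℕ c                        ∎)
    where open ≡-Reasoning

  [c+n*r]/r≡n : ∀ (c : Fin r) n → (toℕ c + n * r) / r ≡ n
  [c+n*r]/r≡n c n = begin
    (toℕ c + n * r) / r    ≡⟨ +-distrib-/-∣ʳ (toℕ c) (divides-refl n) ⟩
    toℕ c / r + n * r / r  ≡⟨ cong₂ _+_ (m<n⇒m/n≡0 (toℕ<n c)) (m*n/n≡m n r) ⟩
    n                      ∎
    where open ≡-Reasoning

  ∈-digits-fromDigits : ∀ s (C : Fin s → Fin r) p → C p ∈ digits s (fromDigits s C)
  ∈-digits-fromDigits (suc s) C 0F = here (sym ([c+n*r]mod-r≡c (C 0F) (fromDigits s (C ∘ 1+))))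
  ∈-digits-fromDigits (suc s) C (1+ p) =
    there (subst (λ n → C (1+ p) ∈ digits s n) (sym ([c+n*r]/r≡n (C 0F) (fromDigits s (C ∘ 1+))))
                 (∈-digits-fromDigits s (C ∘ 1+) p))

module Blocks (r : ℕ) {{_ : NonZero r}} (s N : ℕ) where
  open BaseDigits r

  blockStart : ℕ → ℕ
  blockStart n = 2 ^ (n * suc N)

  blockEnd : ℕ → ℕ
  blockEnd n = 2 ^ (n * suc N + N)

  block : ℕ → ℕ
  block y = ⌊log₂ y ⌋ / suc N

  block-≡ : ∀ {n y} → blockStart n ≤ y → y < blockEnd n → block y ≡ n
  block-≡ {n} {y} start≤y y<end = ≤-antisym (s≤s⁻¹ block<1+n) n≤block
    where
    log-lower : n * suc N ≤ ⌊log₂ y ⌋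
    log-lower = subst (_≤ ⌊log₂ y ⌋) (⌊log₂[2^n]⌋≡n (n * suc N)) (⌊log₂⌋-mono-≤ start≤y)
    log-upper : ⌊log₂ y ⌋ ≤ n * suc N + N
    log-upper = subst (⌊log₂ y ⌋ ≤_) (⌊log₂[2^n]⌋≡n (n * suc N + N)) (⌊log₂⌋-mono-≤ (<⇒≤ y<end))
    n≤block : n ≤ block y
    n≤block = subst (_≤ block y) (m*n/n≡m n (suc N)) (/-monoˡ-≤ (suc N) log-lower)
    block<1+n : block y < suc n
    block<1+n = m<n*o⇒m/o<n (≤-<-trans log-upper
      (subst (n * suc N + N <_) (+-comm (n * suc N) (suc N)) (+-monoʳ-< (n * suc N) (n<1+n N))))

  palette : ℕ → List (Fin r)
  palette y = digits s (block y)

  palette-length : ∀ y → length (palette y) ≡ s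
  palette-length y = length-digits s (block y)

  tuple-palette-block : (C : Fin s → Fin r) →
    ∃ λ n → ∀ p → Throughout (λ y → C p ∈ palette y) (blockStart n) (blockEnd n)
  tuple-palette-block C = fromDigits s C , λ p y start≤y y<end →
    subst (λ n → C p ∈ digits s n) (sym (block-≡ start≤y y<end)) (∈-digits-fromDigits s C p)

  0<blockStart : ∀ n → 0 < blockStart n
  0<blockStart n = m^n>0 2 (n * suc N)

  blockStart*N<blockEnd : ∀ n → blockStart n * N < blockEnd n
  blockStart*N<blockEnd n = begin-strict
    blockStart n * N      <⟨ *-monoʳ-< (blockStart n) {{>-nonZero (0<blockStart n)}} (n<2^n N) ⟩
    blockStart n * 2 ^ N  ≡⟨ ^-distribˡ-+-* 2 (n * suc N) N ⟨
    blockEnd n            ∎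
    where open ≤-Reasoning

flatten : ∀ {a s t} → Fin a × Fin s × Fin t × Fin t → Fin (a * (s * (t * t)))
flatten (u , p , q , d) = combine u (combine p (combine q d))

flatten-injective : ∀ {a s t} → Injective _≡_ _≡_ (flatten {a} {s} {t})
flatten-injective {x = u , p , q , d} {y = u′ , p′ , q′ , d′} eq
  with refl , eq₁ ← combine-injective u _ u′ _ eq
  with refl , eq₂ ← combine-injective p _ p′ _ eq₁
  with refl , refl ← combine-injective q d q′ d′ eq₂ = refl

k∸[k∸t+1]<t : ∀ {k t} → 1 ≤ t → t ≤ k → k ∸ (k ∸ t + 1) < t
k∸[k∸t+1]<t {k} {suc t} _ t<k = begin-strict
  k ∸ (k ∸ suc t + 1)    ≡⟨ ∸-+-assoc k (k ∸ suc t) 1 ⟨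
  k ∸ (k ∸ suc t) ∸ 1    ≡⟨ cong (_∸ 1) (m∸[m∸n]≡n t<k) ⟩
  t                      <⟨ n<1+n t ⟩
  suc t                  ∎
  where open ≤-Reasoning

module Construction (s k t : ℕ) (2≤t : 2 ≤ t) (t≤k : t ≤ k) where

  m : ℕ
  m = k ∸ t + 1

  r : ℕ
  r = s * m + 1

  s*m<r : s * m < r
  s*m<r = m<m+n (s * m) z<s

  instance
    r-nonZero : NonZero r
    r-nonZero = >-nonZero (≤-trans (s≤s z≤n) s*m<r)

  0<t : 0 < t
  0<t = ≤-trans (s≤s z≤n) 2≤t

  k∸m<t : k ∸ m < t
  k∸m<t = k∸[k∸t+1]<t 0<t t≤k

  open Blocks r s (s * (t * t))
  open SmallestVerticesColouring k m s palette palette-length s*m<r public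
    using (φ; colourOf; locate-in-path)

  no-cover : ¬ (Σ (Fin s → Path k) λ P →
                 (∀ j → IsMonoBergePath t φ (P j)) × (∀ x → ∃ λ j → InCore t (P j) x))
  no-cover (P , mono , cover) =
    <⇒≱ (blockStart*N<blockEnd n) (injective⇒≤ {f = code ∘ addressed} λ {x} {y} eq →
      toℕ-injective (code-injective (addressed x) (addressed y) eq))
    where
    n : ℕ
    n = proj₁ (tuple-palette-block (λ p → colourOf (P p) (mono p)))

    a : ℕ
    a = blockStart n

    Addressed : ℕ → Set
    Addressed x = Σ (Fin s) λ p → Σ (Fin a × Fin t × Fin t) λ w → Located t (P p) w x

    addressed : (x : Fin (blockEnd n)) → Addressed (toℕ x)
    addressed x = let p , x∈P = cover (toℕ x) in
      p , locate-in-path k∸m<t 0<t (0<blockStart n) (P p) (mono p)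
            (proj₂ (tuple-palette-block _) p) (toℕ<n x) x∈P

    code : ∀ {x} → Addressed x → Fin (a * (s * (t * t)))
    code (p , (u , q , d) , _) = flatten (u , p , q , d)

    code-injective : ∀ {x y} (α : Addressed x) (β : Addressed y) → code α ≡ code β → x ≡ y
    code-injective (p , (u , q , d) , x∈P) (_ , _ , y∈P) eq
      with refl ← flatten-injective {x = u , p , q , d} eq = located-unique (P p) (mono p) x∈P y∈P

theorem1p6 : (s k t : ℕ) → 2 ≤ t → t ≤ k →
    Σ (Edge k → Fin (s * (k ∸ t + 1) + 1)) λ φ →
      ¬ (Σ (Fin s → Path k) λ P →
           (∀ j → IsMonoBergePath t φ (P j))
           × (∀ x → ∃ λ j → InCore t (P j) x))
theorem1p6 s k t 2≤t t≤k = φ , no-cover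
  where open Construction s k t 2≤t t≤k
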